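{- Let $\mathcal{G}=(V,E_L,E_R)$ be an achievement positional game and let $u,v\in V$ be distinct. Suppose $\{u\},\{v\}\notin E_L\cup E_R$ and that for all $e\in E_L\cup E_R$, $u\in e \iff v\in e$. Let $\mathcal{G}'=\mathcal{G}_u^v=\mathcal{G}_v^u$. Then $o(\mathcal{G}')=o(\mathcal{G})$.
   Context: An achievement positional game is a triple $\mathcal{G}=(V,E_L,E_R)$ where $V$ is a finite set and $E_L, E_R \subseteq 2^V\setminus\{\varnothing\}$ (blue and red edges). Left and Right alternately pick a previously unpicked vertex; whoever first fills (picks all vertices of) an edge of their own color (blue for Left, red for Right) wins; if no one does before all vertices are picked, the game is a draw. For a set of edges $E$ and $S\subseteq V$, $E^{+S}=\{e\setminus S: e\in E\}$ and $E^{ -S}=\{e\in E: e\cap S=\varnothing\}$. $\mathcal{G}_u^v=(V\setminus\{u,v\}, (E_L^{+\{u\}})^{ -\{v\}}, (E_R^{+\{v\}})^{ -\{u\}})$ is the game after Left has picked $u$ and Right has picked $v$. The outcome $o(\mathcal{G})$ is the pair (result under optimal play when Left starts, result under optimal play when Right starts). -}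

module Defs where

open import Data.Nat using (ℕ; zero; suc)
open import Data.Fin using (Fin)
open import Data.Fin.Subset using (Subset; _∈_; _⊆_; Nonempty; _─_; ⁅_⁆; _-_)
open import Data.Bool using (Bool; true; false; _∧_; _∨_; not; if_then_else_)
open import Data.List using (List; []; _∷_; map; filter; foldr; _++_)
open import Data.List.Relation.Unary.All using (All)
open import Data.List.Base using (allFin)
open import Data.Vec using (lookup)
open import Data.Product using (_×_; _,_)
open import Relation.Nullary.Decidable using (yes; no)
open import Relation.Unary using (Decidable)
open import Data.Bool.Properties using (T?)
open import Data.Bool using (T)

-- An achievement positional game whose vertices live in the universe Fin n:
-- V is the vertex set, EL the blue (Left) edges, ER the red (Right) edges.
-- Edge sets are represented by lists (duplicates are irrelevant).
record Game (n : ℕ) : Set where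
  constructor game
  field
    V  : Subset n
    EL : List (Subset n)
    ER : List (Subset n)
open Game public

WellFormed : ∀ {n} → Game n → Set
WellFormed G =
  All (λ e → Nonempty e × e ⊆ V G) (EL G) × All (λ e → Nonempty e × e ⊆ V G) (ER G)

memB : ∀ {n} → Fin n → Subset n → Bool
memB x S = lookup S x

anyFin : ∀ {n} → (Fin n → Bool) → Bool
anyFin {n} p = foldr (λ x b → p x ∨ b) false (allFin n)

allFinB : ∀ {n} → (Fin n → Bool) → Bool
allFinB {n} p = foldr (λ x b → p x ∧ b) true (allFin n)

subB : ∀ {n} → Subset n → Subset n → Bool
subB e A = allFinB (λ x → not (memB x e) ∨ memB x A)

disjointB : ∀ {n} → Subset n → Subset n → Bool
disjointB e S = allFinB (λ x → not (memB x e ∧ memB x S))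

_⁺_ : ∀ {n} → List (Subset n) → Subset n → List (Subset n)
E ⁺ S = map (λ e → e ─ S) E

_⁻_ : ∀ {n} → List (Subset n) → Subset n → List (Subset n)
E ⁻ S = filter (λ e → T? (disjointB e S)) E

-- G_u^v : Left has picked u and Right has picked v.
after : ∀ {n} → Game n → Fin n → Fin n → Game n
after G u v = game ((V G - u) - v) ((EL G ⁺ ⁅ u ⁆) ⁻ ⁅ v ⁆) ((ER G ⁺ ⁅ v ⁆) ⁻ ⁅ u ⁆)

data Player : Set where
  Left Right : Player

data Result : Set where
  RightWins Draw LeftWins : Result

maxR : Result → Result → Result
maxR LeftWins _ = LeftWins
maxR _ LeftWins = LeftWins
maxR Draw _ = Draw
maxR _ Draw = Draw
maxR RightWins RightWins = RightWins

minR : Result → Result → Result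
minR RightWins _ = RightWins
minR _ RightWins = RightWins
minR Draw _ = Draw
minR _ Draw = Draw
minR LeftWins LeftWins = LeftWins

other : Player → Player
other Left = Right
other Right = Left

fills : ∀ {n} → List (Subset n) → Subset n → Bool
fills E A = foldr (λ e b → subB e A ∨ b) false E

insert : ∀ {n} → Fin n → Subset n → Subset n
insert x A = A Data.Fin.Subset.∪ ⁅ x ⁆

-- Value under optimal play of the position where p is to move, R is the set of
-- unpicked vertices, A the vertices picked by Left and B those picked by Right.
-- The fuel argument bounds the number of remaining moves (fuel n suffices,
-- since each move removes a vertex of Fin n from R).
value : ∀ {n} → ℕ → Game n → Player → Subset n → Subset n → Subset n → Result
value zero G p R A B = Draw
value {n} (suc k) G Left R A B =
  if anyFin (λ x → memB x R) then
    foldr (λ x r → if memB x R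
                     then maxR (if fills (EL G) (insert x A) then LeftWins
                                else value k G Right (R - x) (insert x A) B) r
                     else r)
          RightWins (allFin n)
  else Draw
value {n} (suc k) G Right R A B =
  if anyFin (λ x → memB x R) then
    foldr (λ x r → if memB x R
                     then minR (if fills (ER G) (insert x B) then RightWins
                                else value k G Left (R - x) A (insert x B)) r
                     else r)
          LeftWins (allFin n)
  else Draw

result : ∀ {n} → Game n → Player → Result
result {n} G p = value n G p (V G) Data.Fin.Subset.⊥ Data.Fin.Subset.⊥

outcome : ∀ {n} → Game n → Result × Result
outcome G = result G Left , result G Right

module Submission where

-- Since every edge contains both or neither of u and v, G' is G with u, v and all edges through
-- them deleted. Left can play G as G' using the pairing strategy on {u, v}: whenever Right takes
-- one of u, v, Left immediately takes the other. Then Right never owns both, so no red edge through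
-- u or v is ever filled, while the blue ones can only help Left; hence Left does at least as well
-- in G as in G'. Swapping the colours turns this into the same statement for Right, which gives
-- the reverse inequality.

open import Defs
open import Data.Bool using (Bool; true; false; _∧_; _∨_; not; if_then_else_)
open import Data.Bool.Properties using (¬-not; T?; T-≡; ∨-zeroʳ; ∨-identityʳ; ∧-zeroʳ)
open import Data.Empty using (⊥-elim)
open import Data.Fin using (Fin; zero; suc; _≟_)
open import Data.Fin.Subset using (Subset; _∈_; ⁅_⁆; _─_; _-_; ∣_∣; Nonempty) renaming (⊥ to ∅)
open import Data.Fin.Subset.Properties using (x∈p⇒∣p-x∣<∣p∣; ∣p∣≤n)
open import Data.List using (List; []; _∷_; foldr; _++_; allFin)
open import Data.List.Membership.Propositional using () renaming (_∈_ to _∈ₗ_; _∉_ to _∉ₗ_)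
open import Data.List.Membership.Propositional.Properties
  using (∈-allFin; ∈-map⁺; ∈-map⁻; ∈-filter⁺; ∈-filter⁻; ∈-++⁺ˡ; ∈-++⁺ʳ)
open import Data.List.Relation.Unary.Any using (here; there)
import Data.List.Relation.Unary.All as All
open import Data.Nat using (ℕ; zero; suc; _≤_; _⊔_; _⊓_; z≤n; s≤s)
open import Data.Nat.Properties
  using (≤-refl; ≤-trans; ≤-antisym; ≤-pred; <-≤-trans; n≮0; m≤m⊔n; m≤n⊔m; ⊔-lub; m⊓n≤m; m⊓n≤n; ⊓-glb)
open import Data.Product using (_×_; _,_; proj₁; ∃-syntax)
open import Data.Sum using (_⊎_; inj₁; inj₂) renaming (map to ⊎-map; swap to ⊎-swap)
open import Data.Vec using (_∷_)
open import Data.Vec.Properties using ([]=⇒lookup; lookup⇒[]=; lookup-zipWith; lookup-replicate)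
open import Function using (_∘_)
open import Function.Bundles using (_⇔_; Equivalence)
open import Relation.Binary.PropositionalEquality
  using (_≡_; _≢_; refl; sym; trans; cong; cong₂; subst; subst₂; ≢-sym)
open import Relation.Nullary using (¬_; yes; no)

true≢false : true ≢ false
true≢false ()

memB-≢ : ∀ {n} {x y : Fin n} S → memB x S ≡ true → memB y S ≡ false → x ≢ y
memB-≢ S x∈S y∉S refl = true≢false (trans (sym x∈S) y∉S)

memB-∅ : ∀ {n} (x : Fin n) → memB x ∅ ≡ false
memB-∅ x = lookup-replicate x false

memB-⁅x⁆ : ∀ {n} (x : Fin n) → memB x ⁅ x ⁆ ≡ true
memB-⁅x⁆ zero = refl
memB-⁅x⁆ (suc x) = memB-⁅x⁆ x

memB-⁅y⁆ : ∀ {n} {x y : Fin n} → x ≢ y → memB x ⁅ y ⁆ ≡ false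
memB-⁅y⁆ {x = zero} {zero} x≢y = ⊥-elim (x≢y refl)
memB-⁅y⁆ {x = zero} {suc y} _ = refl
memB-⁅y⁆ {x = suc x} {zero} _ = memB-∅ x
memB-⁅y⁆ {x = suc x} {suc y} x≢y = memB-⁅y⁆ (x≢y ∘ cong suc)

memB-insert-self : ∀ {n} (x : Fin n) A → memB x (insert x A) ≡ true
memB-insert-self x A = trans (lookup-zipWith _∨_ x A ⁅ x ⁆) (trans (cong (memB x A ∨_) (memB-⁅x⁆ x)) (∨-zeroʳ _))

memB-insert-other : ∀ {n} {x y : Fin n} A → x ≢ y → memB x (insert y A) ≡ memB x A
memB-insert-other {x = x} {y} A x≢y =
  trans (lookup-zipWith _∨_ x A ⁅ y ⁆) (trans (cong (memB x A ∨_) (memB-⁅y⁆ x≢y)) (∨-identityʳ _))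

memB-─-in : ∀ {n} (x : Fin n) R S → memB x S ≡ true → memB x (R ─ S) ≡ false
memB-─-in zero (_ ∷ R) (true ∷ S) refl = refl
memB-─-in (suc x) (_ ∷ R) (_ ∷ S) x∈S = memB-─-in x R S x∈S

memB-─-out : ∀ {n} (x : Fin n) R S → memB x S ≡ false → memB x (R ─ S) ≡ memB x R
memB-─-out zero (_ ∷ R) (false ∷ S) refl = refl
memB-─-out (suc x) (_ ∷ R) (_ ∷ S) x∉S = memB-─-out x R S x∉S

memB-delete-self : ∀ {n} (x : Fin n) R → memB x (R - x) ≡ false
memB-delete-self x R = memB-─-in x R ⁅ x ⁆ (memB-⁅x⁆ x)

memB-delete-other : ∀ {n} {x y : Fin n} R → x ≢ y → memB x (R - y) ≡ memB x R
memB-delete-other {x = x} R x≢y = memB-─-out x R _ (memB-⁅y⁆ x≢y)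

IsEmpty : ∀ {n} → Subset n → Set
IsEmpty R = ∀ x → memB x R ≡ false

card-delete : ∀ {n} {x : Fin n} {k} R → memB x R ≡ true → ∣ R ∣ ≤ suc k → ∣ R - x ∣ ≤ k
card-delete {x = x} R x∈R ∣R∣≤1+k = ≤-pred (<-≤-trans (x∈p⇒∣p-x∣<∣p∣ (lookup⇒[]= x R x∈R)) ∣R∣≤1+k)

card-nonzero : ∀ {n} {x : Fin n} R → memB x R ≡ true → ¬ (∣ R ∣ ≤ 0)
card-nonzero {x = x} R x∈R ∣R∣≤0 = n≮0 (<-≤-trans (x∈p⇒∣p-x∣<∣p∣ (lookup⇒[]= x R x∈R)) ∣R∣≤0)

card≤0⇒empty : ∀ {n} (R : Subset n) → ∣ R ∣ ≤ 0 → IsEmpty R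
card≤0⇒empty R ∣R∣≤0 x = ¬-not (λ x∈R → card-nonzero R x∈R ∣R∣≤0)

module _ {A : Set} (p : A → Bool) where

  any-foldr⁺ : ∀ {x xs} → x ∈ₗ xs → p x ≡ true → foldr (λ y b → p y ∨ b) false xs ≡ true
  any-foldr⁺ (here refl) px rewrite px = refl
  any-foldr⁺ {xs = y ∷ _} (there x∈xs) px with p y
  ... | true = refl
  ... | false = any-foldr⁺ x∈xs px

  any-foldr⁻ : ∀ xs → foldr (λ y b → p y ∨ b) false xs ≡ true → ∃[ x ] x ∈ₗ xs × p x ≡ true
  any-foldr⁻ (y ∷ xs) found with p y in py
  ... | true = y , here refl , py
  ... | false with any-foldr⁻ xs found
  ...   | x , x∈xs , px = x , there x∈xs , px

  all-foldr⁺ : ∀ xs → (∀ x → p x ≡ true) → foldr (λ y b → p y ∧ b) true xs ≡ true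
  all-foldr⁺ [] _ = refl
  all-foldr⁺ (y ∷ xs) holds rewrite holds y = all-foldr⁺ xs holds

  all-foldr⁻ : ∀ {x xs} → x ∈ₗ xs → foldr (λ y b → p y ∧ b) true xs ≡ true → p x ≡ true
  all-foldr⁻ {xs = y ∷ _} (here refl) holds with p y
  ... | true = refl
  all-foldr⁻ {xs = y ∷ _} (there x∈xs) holds with p y
  ... | true = all-foldr⁻ x∈xs holds

memB⇒anyFin : ∀ {n} {x : Fin n} {R} → memB x R ≡ true → anyFin (λ y → memB y R) ≡ true
memB⇒anyFin {x = x} {R} = any-foldr⁺ (λ y → memB y R) (∈-allFin x)

empty⇒anyFin-false : ∀ {n} {R : Subset n} → IsEmpty R → anyFin (λ y → memB y R) ≡ false
empty⇒anyFin-false {n} {R} empty = ¬-not nonempty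
  where
  nonempty : ¬ (anyFin (λ y → memB y R) ≡ true)
  nonempty any with _ , _ , x∈R ← any-foldr⁻ (λ y → memB y R) (allFin n) any =
    true≢false (trans (sym x∈R) (empty _))

anyFin-false⇒empty : ∀ {n} {R : Subset n} → anyFin (λ y → memB y R) ≡ false → IsEmpty R
anyFin-false⇒empty {R = R} none x =
  ¬-not (λ x∈R → true≢false (trans (sym (memB⇒anyFin {x = x} {R} x∈R)) none))

_⊆ᵇ_ : ∀ {n} → Subset n → Subset n → Set
e ⊆ᵇ S = ∀ x → memB x e ≡ true → memB x S ≡ true

subB-sound : ∀ {n} (e S : Subset n) → subB e S ≡ true → e ⊆ᵇ S
subB-sound e S sub x x∈e
  with all-foldr⁻ (λ y → not (memB y e) ∨ memB y S) (∈-allFin x) sub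
... | x∈S rewrite x∈e = x∈S

subB-complete : ∀ {n} (e S : Subset n) → e ⊆ᵇ S → subB e S ≡ true
subB-complete {n} e S e⊆S = all-foldr⁺ _ (allFin n) pointwise
  where
  pointwise : ∀ x → (not (memB x e) ∨ memB x S) ≡ true
  pointwise x with memB x e in x∈e
  ... | true = e⊆S x x∈e
  ... | false = refl

fills-sound : ∀ {n} {E : List (Subset n)} {S} → fills E S ≡ true → ∃[ e ] e ∈ₗ E × e ⊆ᵇ S
fills-sound {E = E} {S} filled with any-foldr⁻ (λ e → subB e S) E filled
... | e , e∈E , sub = e , e∈E , subB-sound e S sub

fills-complete : ∀ {n} {E : List (Subset n)} S {e} → e ∈ₗ E → e ⊆ᵇ S → fills E S ≡ true
fills-complete S {e} e∈E e⊆S = any-foldr⁺ (λ e → subB e S) e∈E (subB-complete e S e⊆S)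

⊆ᵇ-false : ∀ {n} (e S : Subset n) {x} → e ⊆ᵇ S → memB x S ≡ false → memB x e ≡ false
⊆ᵇ-false e S e⊆S x∉S = ¬-not (λ x∈e → true≢false (trans (sym (e⊆S _ x∈e)) x∉S))

disjoint-⁅⁆-sound : ∀ {n} (e : Subset n) b → disjointB e ⁅ b ⁆ ≡ true → memB b e ≡ false
disjoint-⁅⁆-sound e b disj
  with all-foldr⁻ (λ y → not (memB y e ∧ memB y ⁅ b ⁆)) (∈-allFin b) disj
... | b∉e rewrite memB-⁅x⁆ b with memB b e
...   | false = refl

disjoint-⁅⁆-complete : ∀ {n} (e : Subset n) b → memB b e ≡ false → disjointB e ⁅ b ⁆ ≡ true
disjoint-⁅⁆-complete {n} e b b∉e = all-foldr⁺ _ (allFin n) pointwise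
  where
  pointwise : ∀ x → not (memB x e ∧ memB x ⁅ b ⁆) ≡ true
  pointwise x with x ≟ b
  ... | yes refl rewrite b∉e = refl
  ... | no x≢b rewrite memB-⁅y⁆ x≢b | ∧-zeroʳ (memB x e) = refl

rank : Result → ℕ
rank RightWins = 0
rank Draw = 1
rank LeftWins = 2

infix 4 _⊑_

record _⊑_ (r s : Result) : Set where
  constructor by-rank
  field
    rank-≤ : rank r ≤ rank s

rank-injective : ∀ {r s} → rank r ≡ rank s → r ≡ s
rank-injective {RightWins} {RightWins} _ = refl
rank-injective {Draw} {Draw} _ = refl
rank-injective {LeftWins} {LeftWins} _ = refl

⊑-reflexive : ∀ {r s} → r ≡ s → r ⊑ s
⊑-reflexive refl = by-rank ≤-refl

⊑-trans : ∀ {r s t} → r ⊑ s → s ⊑ t → r ⊑ t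
⊑-trans (by-rank r≤s) (by-rank s≤t) = by-rank (≤-trans r≤s s≤t)

⊑-antisym : ∀ {r s} → r ⊑ s → s ⊑ r → r ≡ s
⊑-antisym (by-rank r≤s) (by-rank s≤r) = rank-injective (≤-antisym r≤s s≤r)

⊑-LeftWins : ∀ r → r ⊑ LeftWins
⊑-LeftWins RightWins = by-rank z≤n
⊑-LeftWins Draw = by-rank (s≤s z≤n)
⊑-LeftWins LeftWins = by-rank ≤-refl

rank-maxR : ∀ r s → rank (maxR r s) ≡ rank r ⊔ rank s
rank-maxR RightWins RightWins = refl
rank-maxR RightWins Draw = refl
rank-maxR RightWins LeftWins = refl
rank-maxR Draw RightWins = refl
rank-maxR Draw Draw = refl
rank-maxR Draw LeftWins = refl
rank-maxR LeftWins RightWins = refl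
rank-maxR LeftWins Draw = refl
rank-maxR LeftWins LeftWins = refl

rank-minR : ∀ r s → rank (minR r s) ≡ rank r ⊓ rank s
rank-minR RightWins RightWins = refl
rank-minR RightWins Draw = refl
rank-minR RightWins LeftWins = refl
rank-minR Draw RightWins = refl
rank-minR Draw Draw = refl
rank-minR Draw LeftWins = refl
rank-minR LeftWins RightWins = refl
rank-minR LeftWins Draw = refl
rank-minR LeftWins LeftWins = refl

maxR-⊑ˡ : ∀ r s → r ⊑ maxR r s
maxR-⊑ˡ r s = by-rank (subst (rank r ≤_) (sym (rank-maxR r s)) (m≤m⊔n _ _))

maxR-⊑ʳ : ∀ r s → s ⊑ maxR r s
maxR-⊑ʳ r s = by-rank (subst (rank s ≤_) (sym (rank-maxR r s)) (m≤n⊔m _ _))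

maxR-lub : ∀ {r s t} → r ⊑ t → s ⊑ t → maxR r s ⊑ t
maxR-lub {r} {s} {t} (by-rank r≤t) (by-rank s≤t) = by-rank (subst (_≤ rank t) (sym (rank-maxR r s)) (⊔-lub r≤t s≤t))

minR-⊑ˡ : ∀ r s → minR r s ⊑ r
minR-⊑ˡ r s = by-rank (subst (_≤ rank r) (sym (rank-minR r s)) (m⊓n≤m _ _))

minR-⊑ʳ : ∀ r s → minR r s ⊑ s
minR-⊑ʳ r s = by-rank (subst (_≤ rank s) (sym (rank-minR r s)) (m⊓n≤n _ _))

minR-glb : ∀ {r s t} → t ⊑ r → t ⊑ s → t ⊑ minR r s
minR-glb {r} {s} {t} (by-rank t≤r) (by-rank t≤s) = by-rank (subst (rank t ≤_) (sym (rank-minR r s)) (⊓-glb t≤r t≤s))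

flipR : Result → Result
flipR RightWins = LeftWins
flipR Draw = Draw
flipR LeftWins = RightWins

flipR-maxR : ∀ r s → flipR (maxR r s) ≡ minR (flipR r) (flipR s)
flipR-maxR RightWins RightWins = refl
flipR-maxR RightWins Draw = refl
flipR-maxR RightWins LeftWins = refl
flipR-maxR Draw RightWins = refl
flipR-maxR Draw Draw = refl
flipR-maxR Draw LeftWins = refl
flipR-maxR LeftWins _ = refl

flipR-minR : ∀ r s → flipR (minR r s) ≡ maxR (flipR r) (flipR s)
flipR-minR RightWins _ = refl
flipR-minR Draw RightWins = refl
flipR-minR Draw Draw = refl
flipR-minR Draw LeftWins = refl
flipR-minR LeftWins RightWins = refl
flipR-minR LeftWins Draw = refl
flipR-minR LeftWins LeftWins = refl

flipR-⊑ : ∀ {r s} → flipR r ⊑ flipR s → s ⊑ r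
flipR-⊑ {RightWins} {RightWins} _ = ⊑-reflexive refl
flipR-⊑ {Draw} {RightWins} _ = by-rank z≤n
flipR-⊑ {Draw} {Draw} _ = ⊑-reflexive refl
flipR-⊑ {LeftWins} {_} _ = ⊑-LeftWins _
flipR-⊑ {RightWins} {Draw} (by-rank (s≤s ()))
flipR-⊑ {RightWins} {LeftWins} (by-rank ())
flipR-⊑ {Draw} {LeftWins} (by-rank ())

module _ {A : Set} (c : A → Bool) (f : A → Result) where

  maxOver : List A → Result
  maxOver = foldr (λ x r → if c x then maxR (f x) r else r) RightWins

  minOver : List A → Result
  minOver = foldr (λ x r → if c x then minR (f x) r else r) LeftWins

  maxOver-ub : ∀ {x xs} → x ∈ₗ xs → c x ≡ true → f x ⊑ maxOver xs
  maxOver-ub {xs = y ∷ ys} (here refl) cx rewrite cx = maxR-⊑ˡ (f y) _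
  maxOver-ub {xs = y ∷ ys} (there x∈ys) cx with c y
  ... | true = ⊑-trans (maxOver-ub x∈ys cx) (maxR-⊑ʳ (f y) _)
  ... | false = maxOver-ub x∈ys cx

  maxOver-lub : ∀ {t} → (∀ x → c x ≡ true → f x ⊑ t) → ∀ xs → maxOver xs ⊑ t
  maxOver-lub bound [] = by-rank z≤n
  maxOver-lub bound (y ∷ ys) with c y in cy
  ... | true = maxR-lub (bound y cy) (maxOver-lub bound ys)
  ... | false = maxOver-lub bound ys

  minOver-lb : ∀ {x xs} → x ∈ₗ xs → c x ≡ true → minOver xs ⊑ f x
  minOver-lb {xs = y ∷ ys} (here refl) cx rewrite cx = minR-⊑ˡ (f y) _
  minOver-lb {xs = y ∷ ys} (there x∈ys) cx with c y
  ... | true = ⊑-trans (minR-⊑ʳ (f y) _) (minOver-lb x∈ys cx)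
  ... | false = minOver-lb x∈ys cx

  minOver-glb : ∀ {t} → (∀ x → c x ≡ true → t ⊑ f x) → ∀ xs → t ⊑ minOver xs
  minOver-glb bound [] = ⊑-LeftWins _
  minOver-glb bound (y ∷ ys) with c y in cy
  ... | true = minR-glb (bound y cy) (minOver-glb bound ys)
  ... | false = minOver-glb bound ys

minOver-flipR : ∀ {A : Set} (c : A → Bool) {f g : A → Result} →
  (∀ x → g x ≡ flipR (f x)) → ∀ xs → minOver c g xs ≡ flipR (maxOver c f xs)
minOver-flipR c pointwise [] = refl
minOver-flipR c {f} pointwise (y ∷ ys) with c y
... | true = trans (cong₂ minR (pointwise y) (minOver-flipR c pointwise ys)) (sym (flipR-maxR (f y) _))
... | false = minOver-flipR c pointwise ys

maxOver-flipR : ∀ {A : Set} (c : A → Bool) {f g : A → Result} →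
  (∀ x → g x ≡ flipR (f x)) → ∀ xs → maxOver c g xs ≡ flipR (minOver c f xs)
maxOver-flipR c pointwise [] = refl
maxOver-flipR c {f} pointwise (y ∷ ys) with c y
... | true = trans (cong₂ maxR (pointwise y) (maxOver-flipR c pointwise ys)) (sym (flipR-minR (f y) _))
... | false = maxOver-flipR c pointwise ys

module _ {n} (k : ℕ) (G : Game n) (R A B : Subset n) where

  leftPick : Fin n → Result
  leftPick x = if fills (EL G) (insert x A) then LeftWins else value k G Right (R - x) (insert x A) B

  rightPick : Fin n → Result
  rightPick x = if fills (ER G) (insert x B) then RightWins else value k G Left (R - x) A (insert x B)

  value-Left-ub : ∀ {x} → memB x R ≡ true → leftPick x ⊑ value (suc k) G Left R A B
  value-Left-ub {x} x∈R rewrite memB⇒anyFin {x = x} {R} x∈R =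
    maxOver-ub (λ y → memB y R) leftPick (∈-allFin x) x∈R

  value-Left-lub : ∀ {t} → (∀ x → memB x R ≡ true → leftPick x ⊑ t) → (IsEmpty R → Draw ⊑ t) →
    value (suc k) G Left R A B ⊑ t
  value-Left-lub bound ifEmpty with anyFin (λ y → memB y R) in any
  ... | true = maxOver-lub (λ y → memB y R) leftPick bound (allFin n)
  ... | false = ifEmpty (anyFin-false⇒empty {R = R} any)

  value-Right-lb : ∀ {x} → memB x R ≡ true → value (suc k) G Right R A B ⊑ rightPick x
  value-Right-lb {x} x∈R rewrite memB⇒anyFin {x = x} {R} x∈R =
    minOver-lb (λ y → memB y R) rightPick (∈-allFin x) x∈R

  value-Right-glb : ∀ {t} → (∀ x → memB x R ≡ true → t ⊑ rightPick x) → (IsEmpty R → t ⊑ Draw) →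
    t ⊑ value (suc k) G Right R A B
  value-Right-glb bound ifEmpty with anyFin (λ y → memB y R) in any
  ... | true = minOver-glb (λ y → memB y R) rightPick bound (allFin n)
  ... | false = ifEmpty (anyFin-false⇒empty {R = R} any)

value-empty : ∀ {n} k (G : Game n) p {R} A B → IsEmpty R → value k G p R A B ≡ Draw
value-empty zero G p A B empty = refl
value-empty (suc k) G Left {R} A B empty rewrite empty⇒anyFin-false {R = R} empty = refl
value-empty (suc k) G Right {R} A B empty rewrite empty⇒anyFin-false {R = R} empty = refl

if-false : ∀ {A : Set} {b} {x y : A} → b ≡ false → (if b then x else y) ≡ y
if-false refl = refl

⊑-if-LeftWins : ∀ b {r} → r ⊑ (if b then LeftWins else r)
⊑-if-LeftWins true = ⊑-LeftWins _
⊑-if-LeftWins false = ⊑-reflexive refl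

if-LeftWins-mono : ∀ {b b' r r'} → (b' ≡ true → b ≡ true) → (b' ≡ false → b ≡ false → r' ⊑ r) →
  (if b' then LeftWins else r') ⊑ (if b then LeftWins else r)
if-LeftWins-mono {true} {_} _ _ = ⊑-LeftWins _
if-LeftWins-mono {false} {true} reflect _ with () ← reflect refl
if-LeftWins-mono {false} {false} _ r'⊑r = r'⊑r refl refl

if-RightWins-mono : ∀ {b b' r r'} → (b ≡ true → b' ≡ true) → (b' ≡ false → b ≡ false → r' ⊑ r) →
  (if b' then RightWins else r') ⊑ (if b then RightWins else r)
if-RightWins-mono {_} {true} _ _ = by-rank z≤n
if-RightWins-mono {true} {false} preserve _ with () ← preserve refl
if-RightWins-mono {false} {false} _ r'⊑r = r'⊑r refl refl

last-pick-draw : ∀ {n} k (G : Game n) {R A B b} → memB b R ≡ true → IsEmpty (R - b) →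
  fills (ER G) (insert b B) ≡ false → ∣ R ∣ ≤ k → Draw ⊑ value k G Right R A B
last-pick-draw zero G {R} b∈R _ _ ∣R∣≤0 = ⊥-elim (card-nonzero R b∈R ∣R∣≤0)
last-pick-draw (suc k) G {R} {A} {B} {b} b∈R rest unfilled _ = value-Right-glb k G R A B {Draw} pick (λ _ → ⊑-reflexive refl)
  where
  pick : ∀ y → memB y R ≡ true → Draw ⊑ rightPick k G R A B y
  pick y y∈R with y ≟ b
  ... | yes refl = ⊑-reflexive (sym (trans (if-false unfilled) (value-empty k G Left A (insert b B) rest)))
  ... | no y≢b = ⊥-elim (true≢false (trans (sym y∈R) (trans (sym (memB-delete-other R y≢b)) (rest y))))

swapColours : ∀ {n} → Game n → Game n
swapColours G = game (V G) (ER G) (EL G)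

value-swapColours : ∀ {n} k (G : Game n) p R A B → value k (swapColours G) p R B A ≡ flipR (value k G (other p) R A B)
value-swapColours zero G p R A B = refl
value-swapColours {n} (suc k) G Left R A B with anyFin (λ x → memB x R)
... | true = maxOver-flipR (λ x → memB x R) pick (allFin n)
  where
  pick : ∀ x → leftPick k (swapColours G) R B A x ≡ flipR (rightPick k G R A B x)
  pick x with fills (ER G) (insert x B)
  ... | true = refl
  ... | false = value-swapColours k G Right (R - x) A (insert x B)
... | false = refl
value-swapColours {n} (suc k) G Right R A B with anyFin (λ x → memB x R)
... | true = minOver-flipR (λ x → memB x R) pick (allFin n)
  where
  pick : ∀ x → rightPick k (swapColours G) R B A x ≡ flipR (leftPick k G R A B x)
  pick x with fills (EL G) (insert x A)
  ... | true = refl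
  ... | false = value-swapColours k G Left (R - x) (insert x A) B
... | false = refl

result-swapColours : ∀ {n} (G : Game n) p → result (swapColours G) p ≡ flipR (result G (other p))
result-swapColours {n} G p = value-swapColours n G p (V G) ∅ ∅

record AgreeOff {n} (a b : Fin n) (S S' : Subset n) : Set where
  constructor agreeOff
  field
    agree : ∀ x → x ≢ a → x ≢ b → memB x S ≡ memB x S'

open AgreeOff

module _ {n} {a b : Fin n} where

  agree-refl : ∀ {S} → AgreeOff a b S S
  agree-refl = agreeOff λ _ _ _ → refl

  agree-sym : ∀ {S S'} → AgreeOff a b S S' → AgreeOff a b S' S
  agree-sym S≈S' = agreeOff λ x x≢a x≢b → sym (agree S≈S' x x≢a x≢b)

  agree-trans : ∀ {S S' S''} → AgreeOff a b S S' → AgreeOff a b S' S'' → AgreeOff a b S S''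
  agree-trans S≈S' S'≈S'' = agreeOff λ x x≢a x≢b → trans (agree S≈S' x x≢a x≢b) (agree S'≈S'' x x≢a x≢b)

  agree-swap : ∀ {S S'} → AgreeOff a b S S' → AgreeOff b a S S'
  agree-swap S≈S' = agreeOff λ x x≢b x≢a → agree S≈S' x x≢a x≢b

  agree-delete-both : ∀ {S S'} y → AgreeOff a b S S' → AgreeOff a b (S - y) (S' - y)
  agree-delete-both {S} {S'} y S≈S' = agreeOff pointwise
    where
    pointwise : ∀ x → x ≢ a → x ≢ b → memB x (S - y) ≡ memB x (S' - y)
    pointwise x x≢a x≢b with x ≟ y
    ... | yes refl = trans (memB-delete-self x S) (sym (memB-delete-self x S'))
    ... | no x≢y = trans (memB-delete-other S x≢y) (trans (agree S≈S' x x≢a x≢b) (sym (memB-delete-other S' x≢y)))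

  agree-insert-both : ∀ {S S'} y → AgreeOff a b S S' → AgreeOff a b (insert y S) (insert y S')
  agree-insert-both {S} {S'} y S≈S' = agreeOff pointwise
    where
    pointwise : ∀ x → x ≢ a → x ≢ b → memB x (insert y S) ≡ memB x (insert y S')
    pointwise x x≢a x≢b with x ≟ y
    ... | yes refl = trans (memB-insert-self x S) (sym (memB-insert-self x S'))
    ... | no x≢y = trans (memB-insert-other S x≢y) (trans (agree S≈S' x x≢a x≢b) (sym (memB-insert-other S' x≢y)))

  agree-delete : ∀ {S S' y} → (∀ {x} → x ≢ a → x ≢ b → x ≢ y) → AgreeOff a b S S' → AgreeOff a b (S - y) S'
  agree-delete {S} avoid S≈S' =
    agreeOff λ x x≢a x≢b → trans (memB-delete-other S (avoid x≢a x≢b)) (agree S≈S' x x≢a x≢b)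

  agree-insert : ∀ {S S' y} → (∀ {x} → x ≢ a → x ≢ b → x ≢ y) → AgreeOff a b S S' → AgreeOff a b (insert y S) S'
  agree-insert {S} avoid S≈S' =
    agreeOff λ x x≢a x≢b → trans (memB-insert-other S (avoid x≢a x≢b)) (agree S≈S' x x≢a x≢b)

  agree-empty : ∀ {S S'} → AgreeOff a b S S' → memB a S' ≡ false → memB b S' ≡ false → IsEmpty S → IsEmpty S'
  agree-empty S≈S' a∉S' b∉S' empty x with x ≟ a | x ≟ b
  ... | yes refl | _ = a∉S'
  ... | no _ | yes refl = b∉S'
  ... | no x≢a | no x≢b = trans (sym (agree S≈S' x x≢a x≢b)) (empty x)

Inseparable : ∀ {n} → List (Subset n) → Fin n → Fin n → Set
Inseparable E a b = ∀ {e} → e ∈ₗ E → memB a e ≡ memB b e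

-- For inseparable E, (E ⁺ ⁅ a ⁆) ⁻ ⁅ b ⁆ consists exactly of the edges of E that avoid a and b.
module _ {n} {E : List (Subset n)} {a b : Fin n} (insep : Inseparable E a b) (a≢b : a ≢ b) where

  fills-restrict⇒fills : ∀ {S S'} → AgreeOff a b S S' → fills ((E ⁺ ⁅ a ⁆) ⁻ ⁅ b ⁆) S' ≡ true → fills E S ≡ true
  fills-restrict⇒fills {S} {S'} S≈S' filled
    with e' , e'∈ , e'⊆S' ← fills-sound {E = (E ⁺ ⁅ a ⁆) ⁻ ⁅ b ⁆} {S'} filled
    with e'∈E⁺ , disjoint ← ∈-filter⁻ (λ e → T? (disjointB e ⁅ b ⁆)) {xs = E ⁺ ⁅ a ⁆} e'∈
    with e , e∈E , refl ← ∈-map⁻ (_─ ⁅ a ⁆) e'∈E⁺ = fills-complete S e∈E e⊆S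
    where
    b∉e : memB b e ≡ false
    b∉e = trans (sym (memB-delete-other e (≢-sym a≢b))) (disjoint-⁅⁆-sound (e ─ ⁅ a ⁆) b (Equivalence.to T-≡ disjoint))
    a∉e : memB a e ≡ false
    a∉e = trans (insep e∈E) b∉e
    e⊆S : e ⊆ᵇ S
    e⊆S x x∈e = trans (agree S≈S' x x≢a (memB-≢ e x∈e b∉e)) (e'⊆S' x (trans (memB-delete-other e x≢a) x∈e))
      where
      x≢a : x ≢ a
      x≢a = memB-≢ e x∈e a∉e

  fills⇒fills-restrict : ∀ {S S'} → AgreeOff a b S S' → memB a S ≡ false ⊎ memB b S ≡ false →
    fills E S ≡ true → fills ((E ⁺ ⁅ a ⁆) ⁻ ⁅ b ⁆) S' ≡ true
  fills⇒fills-restrict {S} {S'} S≈S' a∉S⊎b∉S filled with e , e∈E , e⊆S ← fills-sound {E = E} {S} filled =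
    fills-complete S' e-a∈ e-a⊆S'
    where
    not-both : memB a S ≡ false ⊎ memB b S ≡ false → memB a e ≡ false
    not-both (inj₁ a∉S) = ⊆ᵇ-false e S e⊆S a∉S
    not-both (inj₂ b∉S) = trans (insep e∈E) (⊆ᵇ-false e S e⊆S b∉S)
    a∉e : memB a e ≡ false
    a∉e = not-both a∉S⊎b∉S
    b∉e : memB b e ≡ false
    b∉e = trans (sym (insep e∈E)) a∉e
    e-a∈ : e ─ ⁅ a ⁆ ∈ₗ (E ⁺ ⁅ a ⁆) ⁻ ⁅ b ⁆
    e-a∈ = ∈-filter⁺ (λ e → T? (disjointB e ⁅ b ⁆)) (∈-map⁺ (_─ ⁅ a ⁆) e∈E)
             (Equivalence.from T-≡ (disjoint-⁅⁆-complete (e ─ ⁅ a ⁆) b (trans (memB-delete-other e (≢-sym a≢b)) b∉e)))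
    e-a⊆S' : (e ─ ⁅ a ⁆) ⊆ᵇ S'
    e-a⊆S' x x∈e-a = trans (sym (agree S≈S' x x≢a (memB-≢ e x∈e b∉e))) (e⊆S x x∈e)
      where
      x≢a : x ≢ a
      x≢a = memB-≢ (e ─ ⁅ a ⁆) x∈e-a (memB-delete-self a e)
      x∈e : memB x e ≡ true
      x∈e = trans (sym (memB-delete-other e x≢a)) x∈e-a

  fills-insert : ∀ {B} → memB b B ≡ false → fills E B ≡ false → fills E (insert a B) ≡ false
  fills-insert {B} b∉B unfilled = ¬-not filled-after
    where
    filled-after : ¬ (fills E (insert a B) ≡ true)
    filled-after filled with e , e∈E , e⊆aB ← fills-sound {E = E} {insert a B} filled with memB a e in a∈e
    ... | true = true≢false (trans (sym (e⊆aB b (trans (sym (insep e∈E)) a∈e))) (trans (memB-insert-other B (≢-sym a≢b)) b∉B))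
    ... | false = true≢false (trans (sym (fills-complete B e∈E e⊆B)) unfilled)
      where
      e⊆B : e ⊆ᵇ B
      e⊆B x x∈e = trans (sym (memB-insert-other B (memB-≢ e x∈e a∈e))) (e⊆aB x x∈e)

-- G' is only accessed through the two transfer properties, so that the module also applies to the
-- colour-swapped games.
module PairingStrategy {n} (G G' : Game n) {u v : Fin n} (u≢v : u ≢ v)
  (insepR : Inseparable (ER G) u v)
  (reflectL : ∀ {S S'} → AgreeOff u v S S' → fills (EL G') S' ≡ true → fills (EL G) S ≡ true)
  (preserveR : ∀ {S S'} → AgreeOff u v S S' → memB u S ≡ false ⊎ memB v S ≡ false →
               fills (ER G) S ≡ true → fills (ER G') S' ≡ true)
  where

  data Twin : Fin n → Fin n → Set where
    uv : Twin u v
    vu : Twin v u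

  twin-≢ : ∀ {a b} → Twin a b → a ≢ b
  twin-≢ uv = u≢v
  twin-≢ vu = ≢-sym u≢v

  twin-sym : ∀ {a b} → Twin a b → Twin b a
  twin-sym uv = vu
  twin-sym vu = uv

  twin-avoid : ∀ {a b x} → Twin a b → x ≢ u → x ≢ v → x ≢ a
  twin-avoid uv x≢u _ = x≢u
  twin-avoid vu _ x≢v = x≢v

  twin-unfilled : ∀ {a b} B → Twin a b → memB b B ≡ false → fills (ER G) B ≡ false → fills (ER G) (insert a B) ≡ false
  twin-unfilled B uv = fills-insert insepR u≢v {B}
  twin-unfilled B vu = fills-insert (λ e∈ → sym (insepR e∈)) (≢-sym u≢v) {B}

  pair-deleted-agrees : ∀ R → AgreeOff u v ((R - u) - v) R
  pair-deleted-agrees R = agree-delete (twin-avoid vu) (agree-delete (twin-avoid uv) agree-refl)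

  u∉pair-deleted : ∀ R → memB u ((R - u) - v) ≡ false
  u∉pair-deleted R = trans (memB-delete-other (R - u) u≢v) (memB-delete-self u R)

  v∉pair-deleted : ∀ R → memB v ((R - u) - v) ≡ false
  v∉pair-deleted R = memB-delete-self v (R - u)

  data Pairing (R B : Subset n) : Set where
    intact : memB u R ≡ true → memB v R ≡ true → memB u B ≡ false → memB v B ≡ false → Pairing R B
    split : memB u R ≡ false → memB v R ≡ false → memB u B ≡ false ⊎ memB v B ≡ false → Pairing R B

  pairing-resp : ∀ {R B R₂ B₂} → memB u R₂ ≡ memB u R → memB v R₂ ≡ memB v R →
    memB u B₂ ≡ memB u B → memB v B₂ ≡ memB v B → Pairing R B → Pairing R₂ B₂
  pairing-resp uR vR uB vB (intact u∈R v∈R u∉B v∉B) =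
    intact (trans uR u∈R) (trans vR v∈R) (trans uB u∉B) (trans vB v∉B)
  pairing-resp uR vR uB vB (split u∉R v∉R u∉B⊎v∉B) =
    split (trans uR u∉R) (trans vR v∉R) (⊎-map (trans uB) (trans vB) u∉B⊎v∉B)

  pair-not-taken : ∀ {R B} → Pairing R B → memB u B ≡ false ⊎ memB v B ≡ false
  pair-not-taken (intact _ _ u∉B _) = inj₁ u∉B
  pair-not-taken (split _ _ u∉B⊎v∉B) = u∉B⊎v∉B

  twin-intact : ∀ {a b R B} → Twin a b → memB a R ≡ true → Pairing R B → memB b R ≡ true × memB b B ≡ false
  twin-intact uv _ (intact _ v∈R _ v∉B) = v∈R , v∉B
  twin-intact vu _ (intact u∈R _ u∉B _) = u∈R , u∉B
  twin-intact uv u∈R (split u∉R _ _) = ⊥-elim (true≢false (trans (sym u∈R) u∉R))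
  twin-intact vu v∈R (split _ v∉R _) = ⊥-elim (true≢false (trans (sym v∈R) v∉R))

  twin-split : ∀ {a b R B} → Twin a b → memB a R ≡ false → memB b R ≡ false → memB b B ≡ false → Pairing R B
  twin-split uv u∉R v∉R v∉B = split u∉R v∉R (inj₂ v∉B)
  twin-split vu v∉R u∉R u∉B = split u∉R v∉R (inj₁ u∉B)

  record Related (k k' : ℕ) (R A B R' A' B' : Subset n) : Set where
    field
      fuel : ∣ R ∣ ≤ k
      fuel' : ∣ R' ∣ ≤ k'
      R≈R' : AgreeOff u v R R'
      A≈A' : AgreeOff u v A A'
      B≈B' : AgreeOff u v B B'
      u∉R' : memB u R' ≡ false
      v∉R' : memB v R' ≡ false
      pairing : Pairing R B
      unfilledR : fills (ER G) B ≡ false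

  open Related

  ∈R'⇒ordinary : ∀ {k k' R A B R' A' B' x} → Related k k' R A B R' A' B' → memB x R' ≡ true →
    x ≢ u × x ≢ v × memB x R ≡ true
  ∈R'⇒ordinary {R' = R'} {x = x} rel x∈R' = x≢u , x≢v , trans (agree (R≈R' rel) x x≢u x≢v) x∈R'
    where
    x≢u : x ≢ u
    x≢u = memB-≢ R' x∈R' (u∉R' rel)
    x≢v : x ≢ v
    x≢v = memB-≢ R' x∈R' (v∉R' rel)

  ordinary⇒∈R' : ∀ {k k' R A B R' A' B' x} → Related k k' R A B R' A' B' → x ≢ u → x ≢ v → memB x R ≡ true →
    memB x R' ≡ true
  ordinary⇒∈R' {x = x} rel x≢u x≢v x∈R = trans (sym (agree (R≈R' rel) x x≢u x≢v)) x∈R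

  related-left : ∀ {k k' R A B R' A' B' x} → x ≢ u → x ≢ v → memB x R ≡ true → memB x R' ≡ true →
    Related (suc k) (suc k') R A B R' A' B' → Related k k' (R - x) (insert x A) B (R' - x) (insert x A') B'
  related-left {R = R} {R' = R'} {x = x} x≢u x≢v x∈R x∈R' rel = record
    { fuel = card-delete R x∈R (fuel rel)
    ; fuel' = card-delete R' x∈R' (fuel' rel)
    ; R≈R' = agree-delete-both x (R≈R' rel)
    ; A≈A' = agree-insert-both x (A≈A' rel)
    ; B≈B' = B≈B' rel
    ; u∉R' = trans (memB-delete-other R' (≢-sym x≢u)) (u∉R' rel)
    ; v∉R' = trans (memB-delete-other R' (≢-sym x≢v)) (v∉R' rel)
    ; pairing = pairing-resp (memB-delete-other R (≢-sym x≢u)) (memB-delete-other R (≢-sym x≢v)) refl refl (pairing rel)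
    ; unfilledR = unfilledR rel
    }

  related-right : ∀ {k k' R A B R' A' B' x} → x ≢ u → x ≢ v → memB x R ≡ true → memB x R' ≡ true →
    fills (ER G) (insert x B) ≡ false →
    Related (suc k) (suc k') R A B R' A' B' → Related k k' (R - x) A (insert x B) (R' - x) A' (insert x B')
  related-right {R = R} {B = B} {R' = R'} {x = x} x≢u x≢v x∈R x∈R' unfilled rel = record
    { fuel = card-delete R x∈R (fuel rel)
    ; fuel' = card-delete R' x∈R' (fuel' rel)
    ; R≈R' = agree-delete-both x (R≈R' rel)
    ; A≈A' = A≈A' rel
    ; B≈B' = agree-insert-both x (B≈B' rel)
    ; u∉R' = trans (memB-delete-other R' (≢-sym x≢u)) (u∉R' rel)
    ; v∉R' = trans (memB-delete-other R' (≢-sym x≢v)) (v∉R' rel)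
    ; pairing = pairing-resp (memB-delete-other R (≢-sym x≢u)) (memB-delete-other R (≢-sym x≢v))
                  (memB-insert-other B (≢-sym x≢u)) (memB-insert-other B (≢-sym x≢v)) (pairing rel)
    ; unfilledR = unfilled
    }

  related-twin : ∀ {k k' R A B R' A' B' a b} → Twin a b → memB a R ≡ true →
    Related (suc (suc k)) k' R A B R' A' B' → Related k k' ((R - a) - b) (insert b A) (insert a B) R' A' B'
  related-twin {R = R} {B = B} {a = a} {b} t a∈R rel with b∈R , b∉B ← twin-intact t a∈R (pairing rel) = record
    { fuel = card-delete (R - a) b∈R-a (card-delete R a∈R (fuel rel))
    ; fuel' = fuel' rel
    ; R≈R' = agree-delete (twin-avoid (twin-sym t)) (agree-delete (twin-avoid t) (R≈R' rel))
    ; A≈A' = agree-insert (twin-avoid (twin-sym t)) (A≈A' rel)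
    ; B≈B' = agree-insert (twin-avoid t) (B≈B' rel)
    ; u∉R' = u∉R' rel
    ; v∉R' = v∉R' rel
    ; pairing = twin-split t (trans (memB-delete-other (R - a) (twin-≢ t)) (memB-delete-self a R))
                  (memB-delete-self b (R - a)) (trans (memB-insert-other B (twin-≢ (twin-sym t))) b∉B)
    ; unfilledR = twin-unfilled B t b∉B (unfilledR rel)
    }
    where
    b∈R-a : memB b (R - a) ≡ true
    b∈R-a = trans (memB-delete-other R (twin-≢ (twin-sym t))) b∈R

  -- If u, v are still free when G' is exhausted, Left takes u and forces Right to take v.
  draw-⊑ : ∀ {k k' R A B R' A' B'} → Related k k' R A B R' A' B' → IsEmpty R' → Draw ⊑ value k G Left R A B
  draw-⊑ {k} {R = R} {A} {B} rel R'-empty with pairing rel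
  ... | split u∉R v∉R _ =
    ⊑-reflexive (sym (value-empty k G Left A B (agree-empty (agree-sym (R≈R' rel)) u∉R v∉R R'-empty)))
  ... | intact u∈R v∈R u∉B v∉B = left-takes-u k (fuel rel)
    where
    left-takes-u : ∀ j → ∣ R ∣ ≤ j → Draw ⊑ value j G Left R A B
    left-takes-u zero ∣R∣≤0 = ⊥-elim (card-nonzero R u∈R ∣R∣≤0)
    left-takes-u (suc j) ∣R∣≤1+j =
      ⊑-trans (⊑-trans right-forced (⊑-if-LeftWins (fills (EL G) (insert u A)))) (value-Left-ub j G R A B u∈R)
      where
      rest-empty : IsEmpty ((R - u) - v)
      rest-empty = agree-empty (agree-trans (agree-sym (R≈R' rel)) (agree-sym (pair-deleted-agrees R)))
                     (u∉pair-deleted R) (v∉pair-deleted R) R'-empty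
      right-forced : Draw ⊑ value j G Right (R - u) (insert u A) B
      right-forced = last-pick-draw j G (trans (memB-delete-other R (≢-sym u≢v)) v∈R) rest-empty
                       (twin-unfilled B vu u∉B (unfilledR rel)) (card-delete R u∈R ∣R∣≤1+j)

  mutual
    left : ∀ {k k' R A B R' A' B'} → Related k k' R A B R' A' B' →
      value k' G' Left R' A' B' ⊑ value k G Left R A B
    left {k' = zero} {R' = R'} rel = draw-⊑ rel (card≤0⇒empty R' (fuel' rel))
    left {k' = suc k'} {R' = R'} {A'} {B'} rel = value-Left-lub k' G' R' A' B' (left-move rel) (draw-⊑ rel)

    left-move : ∀ {k k' R A B R' A' B'} → Related k (suc k') R A B R' A' B' →
      ∀ x → memB x R' ≡ true → leftPick k' G' R' A' B' x ⊑ value k G Left R A B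
    left-move {zero} {R = R} rel x x∈R' with _ , _ , x∈R ← ∈R'⇒ordinary rel x∈R' =
      ⊥-elim (card-nonzero R x∈R (fuel rel))
    left-move {suc k} {R = R} {A} {B} rel x x∈R' with x≢u , x≢v , x∈R ← ∈R'⇒ordinary rel x∈R' =
      ⊑-trans (if-LeftWins-mono (reflectL (agree-insert-both x (A≈A' rel)))
                                (λ _ _ → right (related-left x≢u x≢v x∈R x∈R' rel)))
              (value-Left-ub k G R A B x∈R)

    right : ∀ {k k' R A B R' A' B'} → Related k k' R A B R' A' B' →
      value k' G' Right R' A' B' ⊑ value k G Right R A B
    right {zero} {k'} {R = R} {A' = A'} {B'} rel =
      ⊑-reflexive (value-empty k' G' Right A' B' (agree-empty (R≈R' rel) (u∉R' rel) (v∉R' rel) (card≤0⇒empty R (fuel rel))))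
    right {suc k} {k'} {R} {A} {B} {R'} {A'} {B'} rel = value-Right-glb k G R A B (right-move rel)
      (λ R-empty → ⊑-reflexive (value-empty k' G' Right A' B' (agree-empty (R≈R' rel) (u∉R' rel) (v∉R' rel) R-empty)))

    right-move : ∀ {k k' R A B R' A' B'} → Related (suc k) k' R A B R' A' B' →
      ∀ x → memB x R ≡ true → value k' G' Right R' A' B' ⊑ rightPick k G R A B x
    right-move rel x x∈R with x ≟ u | x ≟ v
    ... | yes refl | _ = right-twin uv x∈R rel
    ... | no _ | yes refl = right-twin vu x∈R rel
    ... | no x≢u | no x≢v = right-ordinary x≢u x≢v x∈R rel

    right-ordinary : ∀ {k k' R A B R' A' B' x} → x ≢ u → x ≢ v → memB x R ≡ true → Related (suc k) k' R A B R' A' B' →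
      value k' G' Right R' A' B' ⊑ rightPick k G R A B x
    right-ordinary {k' = zero} {R' = R'} x≢u x≢v x∈R rel =
      ⊥-elim (card-nonzero R' (ordinary⇒∈R' rel x≢u x≢v x∈R) (fuel' rel))
    right-ordinary {k' = suc k'} {B = B} {R'} {A'} {B'} {x} x≢u x≢v x∈R rel =
      ⊑-trans (value-Right-lb k' G' R' A' B' x∈R')
              (if-RightWins-mono (preserveR (agree-insert-both x (B≈B' rel)) not-taken)
                                 (λ _ unfilled → left (related-right x≢u x≢v x∈R x∈R' unfilled rel)))
      where
      x∈R' : memB x R' ≡ true
      x∈R' = ordinary⇒∈R' rel x≢u x≢v x∈R
      not-taken : memB u (insert x B) ≡ false ⊎ memB v (insert x B) ≡ false
      not-taken = ⊎-map (trans (memB-insert-other B (≢-sym x≢u))) (trans (memB-insert-other B (≢-sym x≢v)))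
                    (pair-not-taken (pairing rel))

    -- Left answers with the other twin, and the game returns to a position related to the same one in G'.
    right-twin : ∀ {k k' R A B R' A' B' a b} → Twin a b → memB a R ≡ true → Related (suc k) k' R A B R' A' B' →
      value k' G' Right R' A' B' ⊑ rightPick k G R A B a
    right-twin {zero} {R = R} {a = a} t a∈R rel with b∈R , _ ← twin-intact t a∈R (pairing rel) =
      ⊥-elim (card-nonzero (R - a) (trans (memB-delete-other R (twin-≢ (twin-sym t))) b∈R) (card-delete R a∈R (fuel rel)))
    right-twin {suc k} {R = R} {A} {B} {a = a} {b} t a∈R rel with b∈R , b∉B ← twin-intact t a∈R (pairing rel) =
      ⊑-trans (⊑-trans (right (related-twin t a∈R rel))
                       (⊑-trans (⊑-if-LeftWins (fills (EL G) (insert b A))) (value-Left-ub k G (R - a) A (insert a B) b∈R-a)))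
              (⊑-reflexive (sym (if-false (twin-unfilled B t b∉B (unfilledR rel)))))
      where
      b∈R-a : memB b (R - a) ≡ true
      b∈R-a = trans (memB-delete-other R (twin-≢ (twin-sym t))) b∈R

  pairing-⊑ : ∀ {R} → memB u R ≡ true → memB v R ≡ true → fills (ER G) ∅ ≡ false →
    ∀ p → value n G' p ((R - u) - v) ∅ ∅ ⊑ value n G p R ∅ ∅
  pairing-⊑ {R} u∈R v∈R unfilled = play
    where
    start : Related n n R ∅ ∅ ((R - u) - v) ∅ ∅
    start = record
      { fuel = ∣p∣≤n R
      ; fuel' = ∣p∣≤n ((R - u) - v)
      ; R≈R' = agree-sym (pair-deleted-agrees R)
      ; A≈A' = agree-refl
      ; B≈B' = agree-refl
      ; u∉R' = u∉pair-deleted R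
      ; v∉R' = v∉pair-deleted R
      ; pairing = intact u∈R v∈R (memB-∅ u) (memB-∅ v)
      ; unfilledR = unfilled
      }
    play : ∀ p → value n G' p ((R - u) - v) ∅ ∅ ⊑ value n G p R ∅ ∅
    play Left = left start
    play Right = right start

fills-∅ : ∀ {n} {E : List (Subset n)} → (∀ {e} → e ∈ₗ E → Nonempty e) → fills E ∅ ≡ false
fills-∅ {E = E} nonempty = ¬-not filled-∅
  where
  filled-∅ : ¬ (fills E ∅ ≡ true)
  filled-∅ filled with e , e∈E , e⊆∅ ← fills-sound {E = E} {∅} filled with x , x∈e ← nonempty e∈E =
    true≢false (trans (sym (e⊆∅ x ([]=⇒lookup x∈e))) (memB-∅ x))

⇔-memB : ∀ {n} {x y : Fin n} {S} → (x ∈ S ⇔ y ∈ S) → memB x S ≡ memB y S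
⇔-memB {x = x} {y} {S} x⇔y with memB x S in x∈S | memB y S in y∈S
... | true | true = refl
... | false | false = refl
... | true | false = sym (trans (sym y∈S) ([]=⇒lookup (Equivalence.to x⇔y (lookup⇒[]= x S x∈S))))
... | false | true = trans (sym x∈S) ([]=⇒lookup (Equivalence.from x⇔y (lookup⇒[]= y S y∈S)))

lemma3p7 : ∀ {n} (G : Game n) (u v : Fin n) →
    WellFormed G →
    u ∈ V G → v ∈ V G → u ≢ v →
    ⁅ u ⁆ ∉ₗ (EL G ++ ER G) → ⁅ v ⁆ ∉ₗ (EL G ++ ER G) →
    (∀ e → e ∈ₗ (EL G ++ ER G) → (u ∈ e ⇔ v ∈ e)) →
    outcome (after G u v) ≡ outcome G
-- The hypotheses that ⁅ u ⁆ and ⁅ v ⁆ are not edges follow from inseparability (u ≢ v) and are unused.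
lemma3p7 {n} G u v (wfL , wfR) u∈V v∈V u≢v _ _ u⇔v =
  cong₂ _,_ (⊑-antisym (lower Left) (upper Right)) (⊑-antisym (lower Right) (upper Left))
  where
  G' : Game n
  G' = after G u v
  insepL : Inseparable (EL G) u v
  insepL e∈ = ⇔-memB (u⇔v _ (∈-++⁺ˡ e∈))
  insepR : Inseparable (ER G) v u
  insepR e∈ = sym (⇔-memB (u⇔v _ (∈-++⁺ʳ (EL G) e∈)))
  module Lower = PairingStrategy G G' u≢v (λ e∈ → sym (insepR e∈)) (fills-restrict⇒fills insepL u≢v)
    (λ S≈S' not-both → fills⇒fills-restrict insepR (≢-sym u≢v) (agree-swap S≈S') (⊎-swap not-both))
  module Upper = PairingStrategy (swapColours G) (swapColours G') u≢v insepL
    (λ S≈S' → fills-restrict⇒fills insepR (≢-sym u≢v) (agree-swap S≈S')) (fills⇒fills-restrict insepL u≢v)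
  lower : ∀ p → result G' p ⊑ result G p
  lower = Lower.pairing-⊑ ([]=⇒lookup u∈V) ([]=⇒lookup v∈V) (fills-∅ (λ e∈ → proj₁ (All.lookup wfR e∈)))
  upper : ∀ p → result G (other p) ⊑ result G' (other p)
  upper p = flipR-⊑ (subst₂ _⊑_ (result-swapColours G' p) (result-swapColours G p)
    (Upper.pairing-⊑ ([]=⇒lookup u∈V) ([]=⇒lookup v∈V) (fills-∅ (λ e∈ → proj₁ (All.lookup wfL e∈))) p))
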